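{- It is not the case that SPANNING SETS $\leq$ FLATS; that is, there is no Turing machine running in time polynomial in its input length which, for every matroid $M$, given the list of all spanning sets of $M$ outputs the list of all flats of $M$.
   Context: All matroids are finite. A matroid is described to a Turing machine by a list of subsets of its ground set $E$ ($|E| = n$), each subset encoded by its characteristic vector, with a reasonable encoding (no padding), so a description listing $i$ subsets has length $\Theta(ni)$. For two description types $I_1, I_2$, $I_1 \leq I_2$ means there is a polynomial-time Turing machine producing the $I_2$-description of $M$ from the $I_1$-description of $M$, for every matroid $M$. -}

module Defs where

open import Data.Nat using (ℕ; zero; suc; _+_; _*_; _^_; _≤_)
open import Data.Bool using (Bool; true; false)
open import Data.Fin using (Fin)
open import Data.Fin.Subset using (Subset; _⊆_; _∪_; _∩_; ∣_∣; ⁅_⁆; ⊤; _∉_)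
open import Data.Vec using (Vec; []; _∷_)
open import Data.List using (List; []; _∷_; _++_; concatMap; length)
open import Data.List.Membership.Propositional as LM using ()
open import Data.List.Relation.Unary.Unique.Propositional using (Unique)
open import Data.Maybe using (Maybe; just; nothing)
open import Data.Sum using (_⊎_; inj₁; inj₂)
open import Data.Product using (Σ; _×_; _,_)
open import Function.Bundles using (_⇔_)
open import Relation.Binary.PropositionalEquality using (_≡_; _≢_)

record Matroid (n : ℕ) : Set where
  field
    r     : Subset n → ℕ
    r-card : ∀ X → r X ≤ ∣ X ∣
    r-mono : ∀ {X Y} → X ⊆ Y → r X ≤ r Y
    r-submod : ∀ X Y → r (X ∪ Y) + r (X ∩ Y) ≤ r X + r Y

open Matroid public

IsSpanning : ∀ {n} → Matroid n → Subset n → Set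
IsSpanning M S = r M S ≡ r M ⊤

-- F is a flat iff it is closed: cl(F) = F, i.e. adding any element outside
-- F strictly increases the rank.
IsFlat : ∀ {n} → Matroid n → Subset n → Set
IsFlat M F = ∀ e → e ∉ F → r M (F ∪ ⁅ e ⁆) ≢ r M F

data Sym : Set where
  𝟎 𝟏 ♯ : Sym

bits : ∀ {n} → Subset n → List Sym
bits [] = []
bits (false ∷ v) = 𝟎 ∷ bits v
bits (true ∷ v) = 𝟏 ∷ bits v

encode : ∀ {n} → List (Subset n) → List Sym
encode = concatMap (λ v → bits v ++ (♯ ∷ []))

ListsExactly : ∀ {n} → List (Subset n) → (Subset n → Set) → Set
ListsExactly xs P = Unique xs × (∀ v → (v LM.∈ xs) ⇔ P v)

ListsAll : ∀ {n} → List (Subset n) → (Subset n → Set) → Set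
ListsAll xs P = ∀ v → (v LM.∈ xs) ⇔ P v

data Cell (G : ℕ) : Set where
  blank : Cell G
  sym   : Sym → Cell G
  work  : Fin G → Cell G

data Move : Set where
  L R S : Move

record TM : Set where
  field
    nStates : ℕ      -- states are Fin (suc nStates); Fin.zero is the start state
    nWork   : ℕ
    -- transition: new state (nothing = halt), symbol written, head move
    δ : Fin (suc nStates) → Cell nWork → Maybe (Fin (suc nStates)) × Cell nWork × Move

data Status (Q : ℕ) : Set where
  running : Fin (suc Q) → Status Q
  halted  : Status Q

-- configuration: status, cells left of head (nearest first), head cell,
-- cells right of head (nearest first); all other cells are blank.
record Config (Q G : ℕ) : Set where
  constructor conf
  field
    status : Status Q
    left   : List (Cell G)
    head   : Cell G
    right  : List (Cell G)

open Config public

private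
  uncons : ∀ {G} → List (Cell G) → Cell G × List (Cell G)
  uncons [] = blank , []
  uncons (c ∷ cs) = c , cs

  move : ∀ {Q G} → Status Q → Move → List (Cell G) → Cell G → List (Cell G) → Config Q G
  move s L ls h rs with uncons ls
  ... | (c , ls') = conf s ls' c (h ∷ rs)
  move s R ls h rs with uncons rs
  ... | (c , rs') = conf s (h ∷ ls) c rs'
  move s S ls h rs = conf s ls h rs

step : (M : TM) → Config (TM.nStates M) (TM.nWork M) → Config (TM.nStates M) (TM.nWork M)
step M (conf halted ls h rs) = conf halted ls h rs
step M (conf (running q) ls h rs) with TM.δ M q h
... | (just q' , w , d) = move (running q') d ls w rs
... | (nothing , w , d) = move halted d ls w rs

initial : (M : TM) → List Sym → Config (TM.nStates M) (TM.nWork M)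
initial M [] = conf (running Fin.zero) [] blank []
initial M (s ∷ w) = conf (running Fin.zero) [] (sym s) (Data.List.map sym w)

run : (M : TM) → ℕ → Config (TM.nStates M) (TM.nWork M) → Config (TM.nStates M) (TM.nWork M)
run M zero c = c
run M (suc t) c = run M t (step M c)

HaltsWithin : TM → ℕ → List Sym → Set
HaltsWithin M t w = status (run M t (initial M w)) ≡ halted

-- Output convention: the maximal word of symbols in Sym starting at the head.
private
  readSyms : ∀ {G} → List (Cell G) → List Sym
  readSyms [] = []
  readSyms (sym s ∷ cs) = s ∷ readSyms cs
  readSyms (blank ∷ cs) = []
  readSyms (work _ ∷ cs) = []

outputOf : ∀ {Q G} → Config Q G → List Sym
outputOf c = readSyms (head c ∷ right c)

output : TM → ℕ → List Sym → List Sym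
output M t w = outputOf (run M t (initial M w))

TimeBound : ℕ → ℕ → ℕ
TimeBound c l = c * (suc l) ^ c

SpanningToFlats : TM → ℕ → Set
SpanningToFlats M c =
  ∀ n (N : Matroid n) (ss : List (Subset n)) → ListsExactly ss (IsSpanning N) →
    Σ ℕ λ t → t ≤ TimeBound c (length (encode ss)) ×
      HaltsWithin M t (encode ss) ×
      Σ (List (Subset n)) λ fs → ListsAll fs (IsFlat N) × output M t (encode ss) ≡ encode fs

-- The free matroid on n elements has a single spanning set, E itself, so its
-- spanning-set description has length n + 1; but every one of its 2 ^ n
-- subsets is a flat, so any flats description has length at least 2 ^ n.
-- A machine running for t steps on input w can leave an output of length at
-- most t + |w| + 1, which for large n the polynomial bound on t keeps below 2 ^ n.
module Submission where

open import Defs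
open import Data.Nat using (ℕ)
open import Data.Product using (Σ)
open import Relation.Nullary using (¬_)

open import Data.Nat using (zero; suc; _+_; _*_; _^_; _≤_; _<_; z≤n; s≤s; z<s)
open import Data.Nat.Properties
open import Data.Nat.Tactic.RingSolver using (solve-∀)
open import Data.Bool using (Bool; true; false)
open import Data.Fin.Subset using (Subset; _∪_; _∩_; ∣_∣; ⁅_⁆; ⊤)
open import Data.Fin.Subset.Properties
  using (p⊆q⇒∣p∣≤∣q∣; p⊂q⇒∣p∣<∣q∣; p⊆p∪q; q⊆p∪q; x∈⁅x⁆; ∣p∣≡n⇒p≡⊤; ∣⊤∣≡n)
open import Data.Vec using ([]; _∷_)
open import Data.List using (List; []; _∷_; _++_; length)
open import Data.List.Properties using (length-++; length-map)
open import Data.List.Membership.Propositional using (_∈_)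
open import Data.List.Relation.Unary.Any using (here; there)
open import Data.List.Relation.Unary.AllPairs using ([]; _∷_)
open import Data.List.Relation.Unary.All using ([])
open import Data.Product using (∃-syntax; _,_)
open import Data.Maybe using (just; nothing)
open import Function.Bundles using (mk⇔; Equivalence)
open import Relation.Binary.PropositionalEquality
  using (_≡_; refl; trans; cong; cong₂; module ≡-Reasoning)
import Relation.Binary.PropositionalEquality as ≡

∣p∪q∣+∣p∩q∣≡∣p∣+∣q∣ : ∀ {n} (p q : Subset n) → ∣ p ∪ q ∣ + ∣ p ∩ q ∣ ≡ ∣ p ∣ + ∣ q ∣
∣p∪q∣+∣p∩q∣≡∣p∣+∣q∣ [] [] = refl
∣p∪q∣+∣p∩q∣≡∣p∣+∣q∣ (true ∷ p) (true ∷ q) =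
  cong suc (trans (+-suc ∣ p ∪ q ∣ _) (trans (cong suc (∣p∪q∣+∣p∩q∣≡∣p∣+∣q∣ p q)) (≡.sym (+-suc ∣ p ∣ _))))
∣p∪q∣+∣p∩q∣≡∣p∣+∣q∣ (true ∷ p) (false ∷ q) = cong suc (∣p∪q∣+∣p∩q∣≡∣p∣+∣q∣ p q)
∣p∪q∣+∣p∩q∣≡∣p∣+∣q∣ (false ∷ p) (true ∷ q) =
  trans (cong suc (∣p∪q∣+∣p∩q∣≡∣p∣+∣q∣ p q)) (≡.sym (+-suc ∣ p ∣ _))
∣p∪q∣+∣p∩q∣≡∣p∣+∣q∣ (false ∷ p) (false ∷ q) = ∣p∪q∣+∣p∩q∣≡∣p∣+∣q∣ p q

freeMatroid : ∀ n → Matroid n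
freeMatroid n = record
  { r        = ∣_∣
  ; r-card   = λ _ → ≤-refl
  ; r-mono   = p⊆q⇒∣p∣≤∣q∣
  ; r-submod = λ p q → ≤-reflexive (∣p∪q∣+∣p∩q∣≡∣p∣+∣q∣ p q)
  }

freeMatroid-spanningSets : ∀ n → ListsExactly (⊤ ∷ []) (IsSpanning (freeMatroid n))
freeMatroid-spanningSets n = ([] ∷ []) , λ p → mk⇔ spanning (λ eq → here (⊤-spanning eq))
  where
  spanning : ∀ {p} → p ∈ ⊤ ∷ [] → IsSpanning (freeMatroid n) p
  spanning (here refl) = refl
  ⊤-spanning : ∀ {p} → IsSpanning (freeMatroid n) p → p ≡ ⊤
  ⊤-spanning eq = ∣p∣≡n⇒p≡⊤ (trans eq (∣⊤∣≡n n))

freeMatroid-isFlat : ∀ {n} (F : Subset n) → IsFlat (freeMatroid n) F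
freeMatroid-isFlat F e e∉F = >⇒≢ (p⊂q⇒∣p∣<∣q∣ (p⊆p∪q ⁅ e ⁆ , e , q⊆p∪q F ⁅ e ⁆ (x∈⁅x⁆ e) , e∉F))

tailsWithHead : ∀ {n} → Bool → List (Subset (suc n)) → List (Subset n)
tailsWithHead _     []                 = []
tailsWithHead false ((false ∷ p) ∷ ps) = p ∷ tailsWithHead false ps
tailsWithHead false ((true  ∷ _) ∷ ps) = tailsWithHead false ps
tailsWithHead true  ((false ∷ _) ∷ ps) = tailsWithHead true ps
tailsWithHead true  ((true  ∷ p) ∷ ps) = p ∷ tailsWithHead true ps

∈-tailsWithHead : ∀ {n} b {p : Subset n} ps → (b ∷ p) ∈ ps → p ∈ tailsWithHead b ps
∈-tailsWithHead false ((false ∷ _) ∷ _)  (here refl) = here refl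
∈-tailsWithHead true  ((true  ∷ _) ∷ _)  (here refl) = here refl
∈-tailsWithHead false ((false ∷ _) ∷ ps) (there p∈) = there (∈-tailsWithHead false ps p∈)
∈-tailsWithHead false ((true  ∷ _) ∷ ps) (there p∈) = ∈-tailsWithHead false ps p∈
∈-tailsWithHead true  ((false ∷ _) ∷ ps) (there p∈) = ∈-tailsWithHead true ps p∈
∈-tailsWithHead true  ((true  ∷ _) ∷ ps) (there p∈) = there (∈-tailsWithHead true ps p∈)

length-tailsWithHead : ∀ {n} (ps : List (Subset (suc n))) →
  length (tailsWithHead false ps) + length (tailsWithHead true ps) ≡ length ps
length-tailsWithHead [] = refl
length-tailsWithHead ((false ∷ _) ∷ ps) = cong suc (length-tailsWithHead ps)
length-tailsWithHead ((true  ∷ _) ∷ ps) =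
  trans (+-suc (length (tailsWithHead false ps)) _) (cong suc (length-tailsWithHead ps))

covers⇒2^n≤length : ∀ n (ps : List (Subset n)) → (∀ p → p ∈ ps) → 2 ^ n ≤ length ps
covers⇒2^n≤length zero [] covers with () ← covers []
covers⇒2^n≤length zero (_ ∷ _) covers = s≤s z≤n
covers⇒2^n≤length (suc n) ps covers = begin
  2 ^ n + (2 ^ n + 0)                                              ≡⟨ cong (2 ^ n +_) (+-identityʳ _) ⟩
  2 ^ n + 2 ^ n                                                    ≤⟨ +-mono-≤ (half false) (half true) ⟩
  length (tailsWithHead false ps) + length (tailsWithHead true ps) ≡⟨ length-tailsWithHead ps ⟩
  length ps                                                        ∎
  where
  open ≤-Reasoning
  half : ∀ b → 2 ^ n ≤ length (tailsWithHead b ps)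
  half b = covers⇒2^n≤length n _ (λ p → ∈-tailsWithHead b ps (covers (b ∷ p)))

length-bits : ∀ {n} (p : Subset n) → length (bits p) ≡ n
length-bits []          = refl
length-bits (false ∷ p) = cong suc (length-bits p)
length-bits (true  ∷ p) = cong suc (length-bits p)

length-encode : ∀ {n} (ps : List (Subset n)) → length (encode ps) ≡ length ps * suc n
length-encode []           = refl
length-encode {n} (p ∷ ps) = begin
  length ((bits p ++ ♯ ∷ []) ++ encode ps)              ≡⟨ length-++ (bits p ++ ♯ ∷ []) ⟩
  length (bits p ++ ♯ ∷ []) + length (encode ps)        ≡⟨ cong₂ _+_ length-word (length-encode ps) ⟩
  suc n + length ps * suc n                             ∎
  where
  open ≡-Reasoning
  length-word : length (bits p ++ ♯ ∷ []) ≡ suc n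
  length-word = trans (length-++ (bits p)) (trans (cong (_+ 1) (length-bits p)) (+-comm n 1))

length-right-step : ∀ M c → length (right (step M c)) ≤ suc (length (right c))
length-right-step M (conf halted _ _ _) = n≤1+n _
length-right-step M (conf (running q) _ h []) with TM.δ M q h
... | just _  , _ , L = ≤-refl
... | just _  , _ , R = z≤n
... | just _  , _ , S = z≤n
... | nothing , _ , L = ≤-refl
... | nothing , _ , R = z≤n
... | nothing , _ , S = z≤n
length-right-step M (conf (running q) _ h (_ ∷ _)) with TM.δ M q h
... | just _  , _ , L = ≤-refl
... | just _  , _ , R = m≤n⇒m≤1+n (n≤1+n _)
... | just _  , _ , S = n≤1+n _
... | nothing , _ , L = ≤-refl
... | nothing , _ , R = m≤n⇒m≤1+n (n≤1+n _)
... | nothing , _ , S = n≤1+n _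

length-right-run : ∀ M t c → length (right (run M t c)) ≤ t + length (right c)
length-right-run M zero    c = ≤-refl
length-right-run M (suc t) c = begin
  length (right (run M t (step M c))) ≤⟨ length-right-run M t (step M c) ⟩
  t + length (right (step M c))       ≤⟨ +-monoʳ-≤ t (length-right-step M c) ⟩
  t + suc (length (right c))          ≡⟨ +-suc t _ ⟩
  suc t + length (right c)            ∎
  where open ≤-Reasoning

length-right-initial : ∀ M w → length (right (initial M w)) ≤ length w
length-right-initial M []      = z≤n
length-right-initial M (_ ∷ w) = ≤-trans (≤-reflexive (length-map sym w)) (n≤1+n _)

length-outputOf : ∀ {Q G} (c : Config Q G) → length (outputOf c) ≤ suc (length (right c))
length-outputOf (conf s l h rs) = go h rs
  where
  go : ∀ h rs → length (outputOf (conf s l h rs)) ≤ suc (length rs)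
  go blank    _        = z≤n
  go (work _) _        = z≤n
  go (sym _)  []       = s≤s z≤n
  go (sym _)  (h ∷ rs) = s≤s (go h rs)

length-output : ∀ M t w → length (output M t w) ≤ suc (t + length w)
length-output M t w = begin
  length (output M t w)                        ≤⟨ length-outputOf (run M t (initial M w)) ⟩
  suc (length (right (run M t (initial M w)))) ≤⟨ s≤s (length-right-run M t (initial M w)) ⟩
  suc (t + length (right (initial M w)))       ≤⟨ s≤s (+-monoʳ-≤ t (length-right-initial M w)) ⟩
  suc (t + length w)                           ∎
  where open ≤-Reasoning

n<2^n : ∀ n → n < 2 ^ n
n<2^n zero    = z<s
n<2^n (suc n) = begin-strict
  suc n             <⟨ +-mono-≤ (m^n>0 2 n) (n<2^n n) ⟩
  2 ^ n + 2 ^ n     ≡⟨ cong (2 ^ n +_) (+-identityʳ _) ⟨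
  2 ^ suc n         ∎
  where open ≤-Reasoning

m+c*m^c≤[1+c]*m^[1+c] : ∀ m c → 1 ≤ m → m + c * m ^ c ≤ suc c * m ^ suc c
m+c*m^c≤[1+c]*m^[1+c] m c 1≤m =
  +-mono-≤ (≤-trans (≤-reflexive (≡.sym (*-identityʳ m))) (*-monoʳ-≤ m 1≤m^c))
           (*-monoʳ-≤ c (≤-trans (≤-reflexive (≡.sym (*-identityˡ (m ^ c)))) (*-monoˡ-≤ (m ^ c) 1≤m)))
  where
  1≤m^c : 1 ≤ m ^ c
  1≤m^c = ≤-trans (≤-reflexive (≡.sym (^-zeroˡ c))) (^-monoˡ-≤ c 1≤m)

[2+4d]*d≤2^[4d] : ∀ d → let K = (d + d) + (d + d) in (2 + K) * d ≤ 2 ^ K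
[2+4d]*d≤2^[4d] d = begin
  (2 + (y + y)) * d ≡⟨ ring d ⟩
  suc y * y         ≤⟨ *-mono-≤ (n<2^n y) (<⇒≤ (n<2^n y)) ⟩
  2 ^ y * 2 ^ y     ≡⟨ ^-distribˡ-+-* 2 y y ⟨
  2 ^ (y + y)       ∎
  where
  open ≤-Reasoning
  y : ℕ
  y = d + d
  ring : ∀ d → (2 + ((d + d) + (d + d))) * d ≡ suc (d + d) * (d + d)
  ring = solve-∀

-- The witness n = 2 ^ K with K = 4(c + 1) keeps n + 2 ≤ 2 ^ (1 + K) while (2 + K)(c + 1) ≤ 2 ^ K.
exponential-beats-TimeBound : ∀ c → ∃[ n ] suc (TimeBound c (suc n) + suc n) < 2 ^ n
exponential-beats-TimeBound c = n , (begin-strict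
  suc (c * m ^ c + suc n)   ≡⟨ cong suc (+-comm (c * m ^ c) (suc n)) ⟩
  m + c * m ^ c             ≤⟨ m+c*m^c≤[1+c]*m^[1+c] m c (s≤s z≤n) ⟩
  d * m ^ d                 <⟨ *-monoˡ-< (m ^ d) {{m^n≢0 m d}} (n<2^n d) ⟩
  2 ^ d * m ^ d             ≤⟨ *-monoʳ-≤ (2 ^ d) (^-monoˡ-≤ d m≤2^[1+K]) ⟩
  2 ^ d * (2 ^ suc K) ^ d   ≡⟨ cong (2 ^ d *_) (^-*-assoc 2 (suc K) d) ⟩
  2 ^ d * 2 ^ (suc K * d)   ≡⟨ ^-distribˡ-+-* 2 d (suc K * d) ⟨
  2 ^ ((2 + K) * d)         ≤⟨ ^-monoʳ-≤ 2 ([2+4d]*d≤2^[4d] d) ⟩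
  2 ^ n                     ∎)
  where
  open ≤-Reasoning
  d K n m : ℕ
  d = suc c
  K = (d + d) + (d + d)
  n = 2 ^ K
  m = suc (suc n)
  2≤n : 2 ≤ n
  2≤n = ^-monoʳ-≤ 2 {1} {K} (s≤s z≤n)
  m≤2^[1+K] : m ≤ 2 ^ suc K
  m≤2^[1+K] = begin
    2 + n       ≤⟨ +-monoˡ-≤ n 2≤n ⟩
    n + n       ≡⟨ cong (n +_) (+-identityʳ n) ⟨
    2 ^ suc K   ∎

lemma11 : ¬ (Σ TM λ M → Σ ℕ λ c → SpanningToFlats M c)
lemma11 (M , c , computes)
  with n , output-too-short ← exponential-beats-TimeBound c
  with t , t≤ , _ , fs , fs-flats , out≡ ← computes n (freeMatroid n) (⊤ ∷ []) (freeMatroid-spanningSets n)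
  = <⇒≱ output-too-short (begin
    2 ^ n                                   ≤⟨ covers⇒2^n≤length n fs all-flats-listed ⟩
    length fs                               ≤⟨ m≤m*n (length fs) (suc n) ⟩
    length fs * suc n                       ≡⟨ length-encode fs ⟨
    length (encode fs)                      ≡⟨ cong length out≡ ⟨
    length (output M t w)                   ≤⟨ length-output M t w ⟩
    suc (t + length w)                      ≤⟨ s≤s (+-monoˡ-≤ (length w) t≤) ⟩
    suc (TimeBound c (length w) + length w) ≡⟨ cong (λ l → suc (TimeBound c l + l)) length-w ⟩
    suc (TimeBound c (suc n) + suc n)       ∎)
  where
  open ≤-Reasoning
  w : List Sym
  w = encode (⊤ {n} ∷ [])
  length-w : length w ≡ suc n
  length-w = trans (length-encode (⊤ {n} ∷ [])) (+-identityʳ (suc n))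
  all-flats-listed : ∀ F → F ∈ fs
  all-flats-listed F = Equivalence.from (fs-flats F) (freeMatroid-isFlat F)
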